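{- The normalizer in $\Omega$ of the closed subgroup $\langle\langle\gamma\rangle\rangle=\{\gamma^m: m\in\mathbb{Z}_2\}$ is \[\{\gamma^m z_k : m\in\mathbb{Z}_2,\ k\in\mathbb{Z}_2^\times\}.\]
   Context: $T$ is the rooted binary tree of finite words over $X=\{0,1\}$, $\Omega=\mathrm{Aut}(T)$ with its profinite topology, acting on the right ($(v)(\alpha\beta)=((v)\alpha)\beta$). Each $\alpha\in\Omega$ is uniquely $(\alpha_0,\alpha_1)\tau$ with $\tau\in\{\mathrm{id},\sigma\}$, meaning $(xv)\alpha=(x)\tau\,(v)\alpha_x$. For $m\in\mathbb{Z}_2$, $\alpha^m$ is the $2$-adic limit of integer powers. The standard odometer is $\gamma=(\gamma,\mathrm{id})\sigma$. For $k\in\mathbb{Z}_2^\times$ put $\ell=(k-1)/2$ and define $z_k\in\Omega$ recursively by $z_k=(z_k,\gamma^\ell z_k)$ (trivial on level 1). -}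

module Defs where

open import Data.Bool using (Bool; true; false)
open import Data.Nat using (ℕ; zero; suc; _+_; _*_)
open import Data.List using (List; []; _∷_; _∷ʳ_; length)
open import Data.Product using (Σ; ∃; _×_; _,_)
open import Relation.Binary.PropositionalEquality using (_≡_)

-- Letters X = {0,1} encoded as Bool (0 = false, 1 = true).
-- Vertices of T: finite words over X; the first letter is the top-level letter.
Word : Set
Word = List Bool

record Aut : Set where
  field
    fun       : Word → Word
    inv       : Word → Word
    inv-fun   : ∀ v → inv (fun v) ≡ v
    fun-inv   : ∀ v → fun (inv v) ≡ v
    fun-child : ∀ v x → ∃ λ y → fun (v ∷ʳ x) ≡ fun v ∷ʳ y
    inv-child : ∀ v x → ∃ λ y → inv (v ∷ʳ x) ≡ inv v ∷ʳ y
open Aut public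

-- 2-adic integers as digit streams (digit i is the coefficient of 2^i).
ℤ₂ : Set
ℤ₂ = ℕ → Bool

-- units of ℤ₂: the odd 2-adic integers
IsUnit : ℤ₂ → Set
IsUnit k = k 0 ≡ true

bit : Bool → ℕ
bit false = 0
bit true  = 1

trunc : ℤ₂ → ℕ → ℕ
trunc m zero    = 0
trunc m (suc n) = bit (m 0) + 2 * trunc (λ i → m (suc i)) n

-- for odd k, ℓ = (k - 1)/2 : drop the lowest digit
half-pred : ℤ₂ → ℤ₂
half-pred k i = k (suc i)

γ : Word → Word
γ []          = []
γ (false ∷ v) = true ∷ γ v
γ (true ∷ v)  = false ∷ v

iter : ℕ → (Word → Word) → Word → Word
iter zero    f v = v
iter (suc n) f v = iter n f (f v)

-- γ^m for m ∈ ℤ₂: on a word of length n, the 2-adic limit of integer powers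
-- agrees with γ^(m mod 2^n), since γ^(2^n) acts trivially on level n.
γ^ : ℤ₂ → Word → Word
γ^ m v = iter (trunc m (length v)) γ v

-- z_k = (z_k , γ^ℓ z_k):  (0v)z_k = 0 (v)z_k ,  (1v)z_k = 1 ((v)γ^ℓ)z_k .
-- Fuel = length of the word (γ^ℓ preserves length).
zAux : ℤ₂ → ℕ → Word → Word
zAux k fuel          []          = []
zAux k zero          (x ∷ v)     = x ∷ v
zAux k (suc fuel)    (false ∷ v) = false ∷ zAux k fuel v
zAux k (suc fuel)    (true ∷ v)  = true ∷ zAux k fuel (γ^ (half-pred k) v)

z : ℤ₂ → Word → Word
z k v = zAux k (length v) v

_≈_ : (Word → Word) → (Word → Word) → Set
f ≈ g = ∀ v → f v ≡ g v

-- Right action: (v)(αβ) = ((v)α)β.  Conjugate α⁻¹ β α as a map on words.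
conj : Aut → (Word → Word) → (Word → Word)
conj α g v = fun α (g (inv α v))

In⟨⟨γ⟩⟩ : (Word → Word) → Set
In⟨⟨γ⟩⟩ g = ∃ λ (m : ℤ₂) → g ≈ γ^ m

-- α normalizes ⟨⟨γ⟩⟩ :  α⁻¹ ⟨⟨γ⟩⟩ α = ⟨⟨γ⟩⟩
-- (⊆: conjugates of members are members; ⊇: every member is such a conjugate)
Normalizes : Aut → Set
Normalizes α =
  (∀ m → In⟨⟨γ⟩⟩ (conj α (γ^ m))) ×
  (∀ m → ∃ λ (m' : ℤ₂) → γ^ m ≈ conj α (γ^ m'))

-- α = γ^m z_k for some m ∈ ℤ₂, k ∈ ℤ₂^×   (right action: first γ^m, then z_k)
InGammaZ : Aut → Set
InGammaZ α = ∃ λ (m : ℤ₂) → ∃ λ (k : ℤ₂) → IsUnit k × (fun α ≈ λ v → z k (γ^ m v))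

-- Read a vertex of level n as a residue mod 2ⁿ (binary, lowest digit first). Then γ^m acts on
-- level n as x ↦ x − m and, for a unit k, z_k acts as x ↦ k⁻¹ x; so γ^m z_k is the affine map
-- x ↦ k⁻¹ (x − m), and conjugating the translation γ^m′ by it gives the translation γ^(k⁻¹ m′).
-- Conversely, if α⁻¹ γ α = γ^K then α intertwines γ with γ^K; since γ is transitive on every
-- level, α acts as x ↦ b + K x, K is odd because α is injective, and such a map is γ^m z_k
-- with k = K⁻¹ and m = − k b. The 2-adic integers k⁻¹, k m and − k b are obtained as limits of
-- coherent sequences of residues.
module Submission where

open import Defs
open import Data.Bool using (Bool; true; false)
open import Data.Empty using (⊥-elim)
open import Data.Integer using (ℤ; NonZero; ≢-nonZero; _%_; _/_; +_; _+_; _*_; _-_; -_; _^_; ∣_∣)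
open import Data.Integer.Divisibility.Signed
  using (_∣_; divides; ∣-trans; ∣m∣n⇒∣m+n; ∣m⇒∣-m; ∣m⇒∣m*n; ∣n⇒∣m*n; *-monoʳ-∣; *-cancelˡ-∣)
open import Data.Integer.DivMod using (a≡a%n+[a/n]*n)
import Data.Integer.Properties as ℤ
open import Data.Integer.Tactic.RingSolver using (solve-∀)
open import Data.List using ([]; _∷_; _∷ʳ_; length; replicate; last; initLast; _∷ʳ′_)
import Data.List.Properties as List
open import Data.Maybe using (just; fromMaybe)
open import Data.Nat using (ℕ; zero; suc)
import Data.Nat.Base as ℕ
import Data.Nat.Properties as ℕ
open import Data.Product using (∃; _×_; _,_; proj₁; proj₂)
open import Function.Base using (case_of_)
open import Function.Bundles using (_⇔_; mk⇔)
open import Relation.Binary.Bundles using (Setoid)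
open import Relation.Binary.PropositionalEquality
import Relation.Binary.Reasoning.Setoid as SetoidReasoning
open import Relation.Nullary using (¬_)

*-distribˡ-minus : ∀ c a b → c * (a - b) ≡ c * a - c * b
*-distribˡ-minus = solve-∀

infix 4 _≡_[mod_]

record _≡_[mod_] (a b M : ℤ) : Set where
  constructor congruent
  field divides-difference : M ∣ a - b

module _ {M : ℤ} where

  ≡⇒≡mod : ∀ {a b} → a ≡ b → a ≡ b [mod M ]
  ≡⇒≡mod {a} refl = congruent (divides (+ 0) (ℤ.+-inverseʳ a))

  ≡mod-refl : ∀ {a} → a ≡ a [mod M ]
  ≡mod-refl = ≡⇒≡mod refl

  ≡mod-sym : ∀ {a b} → a ≡ b [mod M ] → b ≡ a [mod M ]
  ≡mod-sym {a} {b} (congruent M∣a-b) = congruent (subst (M ∣_) (flip a b) (∣m⇒∣-m M∣a-b))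
    where flip : ∀ a b → - (a - b) ≡ b - a
          flip = solve-∀

  ≡mod-trans : ∀ {a b c} → a ≡ b [mod M ] → b ≡ c [mod M ] → a ≡ c [mod M ]
  ≡mod-trans {a} {b} {c} (congruent M∣a-b) (congruent M∣b-c) =
    congruent (subst (M ∣_) (ℤ.+-minus-telescope a b c) (∣m∣n⇒∣m+n M∣a-b M∣b-c))

  +-cong-mod : ∀ {a b c d} → a ≡ b [mod M ] → c ≡ d [mod M ] → a + c ≡ b + d [mod M ]
  +-cong-mod {a} {b} {c} {d} (congruent M∣a-b) (congruent M∣c-d) =
    congruent (subst (M ∣_) (regroup a b c d) (∣m∣n⇒∣m+n M∣a-b M∣c-d))
    where regroup : ∀ a b c d → (a - b) + (c - d) ≡ (a + c) - (b + d)
          regroup = solve-∀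

  +-congˡ-mod : ∀ c {a b} → a ≡ b [mod M ] → c + a ≡ c + b [mod M ]
  +-congˡ-mod c = +-cong-mod (≡mod-refl {c})

  +-congʳ-mod : ∀ c {a b} → a ≡ b [mod M ] → a + c ≡ b + c [mod M ]
  +-congʳ-mod c a≡b = +-cong-mod a≡b (≡mod-refl {c})

  *-cong-mod : ∀ {a b c d} → a ≡ b [mod M ] → c ≡ d [mod M ] → a * c ≡ b * d [mod M ]
  *-cong-mod {a} {b} {c} {d} (congruent M∣a-b) (congruent M∣c-d) =
    congruent (subst (M ∣_) (regroup a b c d) (∣m∣n⇒∣m+n (∣m⇒∣m*n c M∣a-b) (∣n⇒∣m*n b M∣c-d)))
    where regroup : ∀ a b c d → (a - b) * c + b * (c - d) ≡ a * c - b * d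
          regroup = solve-∀

  *-congˡ-mod : ∀ c {a b} → a ≡ b [mod M ] → c * a ≡ c * b [mod M ]
  *-congˡ-mod c = *-cong-mod (≡mod-refl {c})

  *-congʳ-mod : ∀ c {a b} → a ≡ b [mod M ] → a * c ≡ b * c [mod M ]
  *-congʳ-mod c a≡b = *-cong-mod a≡b (≡mod-refl {c})

  -‿cong-mod : ∀ {a b} → a ≡ b [mod M ] → - a ≡ - b [mod M ]
  -‿cong-mod {a} {b} (congruent M∣a-b) = congruent (subst (M ∣_) (regroup a b) (∣m⇒∣-m M∣a-b))
    where regroup : ∀ a b → - (a - b) ≡ - a - - b
          regroup = solve-∀

  +-cancelˡ-mod : ∀ {a b} c → c + a ≡ c + b [mod M ] → a ≡ b [mod M ]
  +-cancelˡ-mod {a} {b} c (congruent M∣c+a-c+b) = congruent (subst (M ∣_) (cancel c a b) M∣c+a-c+b)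
    where cancel : ∀ c a b → (c + a) - (c + b) ≡ a - b
          cancel = solve-∀

  +-multiple-mod : ∀ a c → a + c * M ≡ a [mod M ]
  +-multiple-mod a c = congruent (divides c (cancel a c M))
    where cancel : ∀ a c M → a + c * M - a ≡ c * M
          cancel = solve-∀

≡mod-setoid : ℤ → Setoid _ _
≡mod-setoid M = record
  { Carrier = ℤ
  ; _≈_ = λ a b → a ≡ b [mod M ]
  ; isEquivalence = record { refl = ≡mod-refl ; sym = ≡mod-sym ; trans = ≡mod-trans }
  }

module ≡mod-Reasoning (M : ℤ) = SetoidReasoning (≡mod-setoid M)

invertible-cancel : ∀ {M a b} c u → c * u ≡ + 1 [mod M ] → c * a ≡ c * b [mod M ] → a ≡ b [mod M ]
invertible-cancel {M} {a} {b} c u cu≡1 ca≡cb = begin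
  a              ≡⟨ ℤ.*-identityˡ a ⟨
  + 1 * a        ≈⟨ *-congʳ-mod a cu≡1 ⟨
  c * u * a      ≡⟨ swap c u a ⟩
  u * (c * a)    ≈⟨ *-congˡ-mod u ca≡cb ⟩
  u * (c * b)    ≡⟨ swap c u b ⟨
  c * u * b      ≈⟨ *-congʳ-mod b cu≡1 ⟩
  + 1 * b        ≡⟨ ℤ.*-identityˡ b ⟩
  b              ∎
  where
  open ≡mod-Reasoning M
  swap : ∀ c u a → c * u * a ≡ u * (c * a)
  swap = solve-∀

≡mod-divisor : ∀ {a b M N} → M ∣ N → a ≡ b [mod N ] → a ≡ b [mod M ]
≡mod-divisor M∣N (congruent N∣a-b) = congruent (∣-trans M∣N N∣a-b)

*-scale-mod : ∀ {a b M} c → a ≡ b [mod M ] → c * a ≡ c * b [mod c * M ]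
*-scale-mod {a} {b} c (congruent M∣a-b) =
  congruent (subst (c * _ ∣_) (*-distribˡ-minus c a b) (*-monoʳ-∣ c M∣a-b))

*-cancelˡ-mod : ∀ {a b M} c .{{_ : NonZero c}} → c * a ≡ c * b [mod c * M ] → a ≡ b [mod M ]
*-cancelˡ-mod {a} {b} c (congruent cM∣ca-cb) =
  congruent (*-cancelˡ-∣ c (subst (c * _ ∣_) (sym (*-distribˡ-minus c a b)) cM∣ca-cb))

≡mod-1 : ∀ {a b} → a ≡ b [mod + 1 ]
≡mod-1 {a} {b} = congruent (divides (a - b) (sym (ℤ.*-identityʳ (a - b))))

1≢0-mod-2 : ¬ (+ 1 ≡ + 0 [mod + 2 ])
1≢0-mod-2 (congruent (divides q 1≡2q)) =
  ℕ.even≢odd ∣ q ∣ 0 (sym (trans (cong ∣_∣ 1≡2q) (trans (ℤ.abs-* q (+ 2)) (ℕ.*-comm ∣ q ∣ 2))))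

2^_ : ℕ → ℤ
2^ n = (+ 2) ^ n

≡mod-2^-cong : ∀ {a b m n} → m ≡ n → a ≡ b [mod 2^ m ] → a ≡ b [mod 2^ n ]
≡mod-2^-cong refl a≡b = a≡b

digit : Bool → ℤ
digit b = + bit b

value : Word → ℤ
value []      = + 0
value (x ∷ v) = digit x + + 2 * value v

value-∷ʳ : ∀ u x → value (u ∷ʳ x) ≡ value u + 2^ length u * digit x
value-∷ʳ []      x = lowest (digit x)
  where lowest : ∀ d → d + + 2 * + 0 ≡ + 0 + + 1 * d
        lowest = solve-∀
value-∷ʳ (y ∷ u) x = begin
  digit y + + 2 * value (u ∷ʳ x)                        ≡⟨ cong (λ t → digit y + + 2 * t) (value-∷ʳ u x) ⟩
  digit y + + 2 * (value u + 2^ length u * digit x)     ≡⟨ regroup (digit y) (value u) (2^ length u) (digit x) ⟩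
  digit y + + 2 * value u + + 2 * 2^ length u * digit x ∎
  where
  open ≡-Reasoning
  regroup : ∀ d v p e → d + + 2 * (v + p * e) ≡ d + + 2 * v + + 2 * p * e
  regroup = solve-∀

value-∷ʳ-mod : ∀ u x → value (u ∷ʳ x) ≡ value u [mod 2^ length u ]
value-∷ʳ-mod u x = begin
  value (u ∷ʳ x)                   ≡⟨ value-∷ʳ u x ⟩
  value u + 2^ length u * digit x  ≡⟨ cong (λ t → value u + t) (ℤ.*-comm (2^ length u) (digit x)) ⟩
  value u + digit x * 2^ length u  ≈⟨ +-multiple-mod (value u) (digit x) ⟩
  value u                          ∎
  where open ≡mod-Reasoning (2^ length u)

digit-injective-mod-2 : ∀ {x y} → digit x ≡ digit y [mod + 2 ] → x ≡ y
digit-injective-mod-2 {false} {false} _ = refl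
digit-injective-mod-2 {true}  {true}  _ = refl
digit-injective-mod-2 {false} {true}  0≡1 = ⊥-elim (1≢0-mod-2 (≡mod-sym 0≡1))
digit-injective-mod-2 {true}  {false} 1≡0 = ⊥-elim (1≢0-mod-2 1≡0)

value-mod-2 : ∀ x u → value (x ∷ u) ≡ digit x [mod + 2 ]
value-mod-2 x u = begin
  digit x + + 2 * value u    ≡⟨ cong (λ t → digit x + t) (ℤ.*-comm (+ 2) (value u)) ⟩
  digit x + value u * + 2    ≈⟨ +-multiple-mod (digit x) (value u) ⟩
  digit x                    ∎
  where open ≡mod-Reasoning (+ 2)

lowest-digit-injective : ∀ x u y v M → value (x ∷ u) ≡ value (y ∷ v) [mod + 2 * M ] → x ≡ y
lowest-digit-injective x u y v M xu≡yv = digit-injective-mod-2 (begin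
  digit x          ≈⟨ value-mod-2 x u ⟨
  value (x ∷ u)    ≈⟨ ≡mod-divisor (divides M (ℤ.*-comm (+ 2) M)) xu≡yv ⟩
  value (y ∷ v)    ≈⟨ value-mod-2 y v ⟩
  digit y          ∎)
  where open ≡mod-Reasoning (+ 2)

value-injective : ∀ {u v} → length u ≡ length v → value u ≡ value v [mod 2^ length u ] → u ≡ v
value-injective {[]}    {[]}    _   _  = refl
value-injective {x ∷ u} {y ∷ v} len xu≡yv with refl ← lowest-digit-injective x u y v (2^ length u) xu≡yv =
  cong (x ∷_) (value-injective (ℕ.suc-injective len) (*-cancelˡ-mod (+ 2) (+-cancelˡ-mod (digit x) xu≡yv)))

truncℤ : ℤ₂ → ℕ → ℤ
truncℤ m n = + trunc m n

truncℤ-suc : ∀ m n → truncℤ m (suc n) ≡ digit (m 0) + + 2 * truncℤ (half-pred m) n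
truncℤ-suc m n = trans (ℤ.pos-+ (bit (m 0)) (2 ℕ.* trunc (half-pred m) n))
                       (cong (λ t → digit (m 0) + t) (ℤ.pos-* 2 (trunc (half-pred m) n)))

truncℤ-coherent : ∀ m n → truncℤ m (suc n) ≡ truncℤ m n [mod 2^ n ]
truncℤ-coherent m zero    = ≡mod-1
truncℤ-coherent m (suc n) = begin
  truncℤ m (suc (suc n))                           ≡⟨ truncℤ-suc m (suc n) ⟩
  digit (m 0) + + 2 * truncℤ (half-pred m) (suc n) ≈⟨ +-congˡ-mod (digit (m 0)) (*-scale-mod (+ 2) ℓ-coherent) ⟩
  digit (m 0) + + 2 * truncℤ (half-pred m) n       ≡⟨ truncℤ-suc m n ⟨
  truncℤ m (suc n)                                 ∎
  where
  open ≡mod-Reasoning (2^ suc n)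
  ℓ-coherent : truncℤ (half-pred m) (suc n) ≡ truncℤ (half-pred m) n [mod 2^ n ]
  ℓ-coherent = truncℤ-coherent (half-pred m) n

digits : ℤ₂ → ℕ → Word
digits m zero    = []
digits m (suc n) = m 0 ∷ digits (half-pred m) n

value-digits : ∀ m n → value (digits m n) ≡ truncℤ m n
value-digits m zero    = refl
value-digits m (suc n) =
  trans (cong (λ t → digit (m 0) + + 2 * t) (value-digits (half-pred m) n)) (sym (truncℤ-suc m n))

digits-suc : ∀ m n → digits m (suc n) ≡ digits m n ∷ʳ m n
digits-suc m zero    = refl
digits-suc m (suc n) = cong (m 0 ∷_) (digits-suc (half-pred m) n)

length-iter : ∀ {f : Word → Word} → (∀ v → length (f v) ≡ length v) →
              ∀ j v → length (iter j f v) ≡ length v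
length-iter f-pres zero    v = refl
length-iter {f} f-pres (suc j) v = trans (length-iter f-pres j (f v)) (f-pres v)

length-γ : ∀ v → length (γ v) ≡ length v
length-γ []          = refl
length-γ (false ∷ v) = cong suc (length-γ v)
length-γ (true ∷ v)  = refl

length-γ^ : ∀ m v → length (γ^ m v) ≡ length v
length-γ^ m v = length-iter length-γ (trunc m (length v)) v

length-zAux : ∀ k n v → length (zAux k n v) ≡ length v
length-zAux k n       []          = refl
length-zAux k zero    (x ∷ v)     = refl
length-zAux k (suc n) (false ∷ v) = cong suc (length-zAux k n v)
length-zAux k (suc n) (true ∷ v)  =
  cong suc (trans (length-zAux k n (γ^ (half-pred k) v)) (length-γ^ (half-pred k) v))

length-z : ∀ k v → length (z k v) ≡ length v
length-z k v = length-zAux k (length v) v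

value-γ : ∀ v → value (γ v) ≡ value v - + 1 [mod 2^ length v ]
value-γ []          = ≡mod-1
value-γ (false ∷ v) = begin
  + 1 + + 2 * value (γ v)          ≈⟨ +-congˡ-mod (+ 1) (*-scale-mod (+ 2) (value-γ v)) ⟩
  + 1 + + 2 * (value v - + 1)      ≡⟨ regroup (value v) ⟩
  + 0 + + 2 * value v - + 1        ∎
  where
  open ≡mod-Reasoning (2^ length (false ∷ v))
  regroup : ∀ a → + 1 + + 2 * (a - + 1) ≡ + 0 + + 2 * a - + 1
  regroup = solve-∀
value-γ (true ∷ v)  = ≡⇒≡mod (regroup (value v))
  where regroup : ∀ a → + 0 + + 2 * a ≡ + 1 + + 2 * a - + 1
        regroup = solve-∀

value-iter-γ : ∀ j v → value (iter j γ v) ≡ value v - + j [mod 2^ length v ]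
value-iter-γ zero    v = ≡⇒≡mod (sym (ℤ.+-identityʳ (value v)))
value-iter-γ (suc j) v = begin
  value (iter j γ (γ v))    ≈⟨ ≡mod-2^-cong (length-γ v) (value-iter-γ j (γ v)) ⟩
  value (γ v) - + j         ≈⟨ +-congʳ-mod (- + j) (value-γ v) ⟩
  value v - + 1 - + j       ≡⟨ regroup (value v) (+ j) ⟩
  value v - (+ 1 + + j)     ∎
  where
  open ≡mod-Reasoning (2^ length v)
  regroup : ∀ a j → a - + 1 - j ≡ a - (+ 1 + j)
  regroup = solve-∀

value-γ^ : ∀ m {n} v → length v ≡ n → value (γ^ m v) ≡ value v - truncℤ m n [mod 2^ n ]
value-γ^ m v refl = value-iter-γ (trunc m (length v)) v

2^-nonZero : ∀ n → NonZero (2^ n)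
2^-nonZero n = ≢-nonZero (λ 2^n≡0 → case ℤ.i^n≡0⇒i≡0 (+ 2) n 2^n≡0 of λ ())

residue-negated : ∀ n x → ∃ λ j → - + j ≡ x [mod 2^ n ]
residue-negated n x = j , congruent (divides q (cancel (+ j) x q (2^ n) -x≡j+q2^n))
  where
  instance
    2^n≢0 : NonZero (2^ n)
    2^n≢0 = 2^-nonZero n
  j : ℕ
  j = (- x) % 2^ n
  q : ℤ
  q = (- x) / 2^ n
  -x≡j+q2^n : - x ≡ + j + q * 2^ n
  -x≡j+q2^n = a≡a%n+[a/n]*n (- x) (2^ n)
  cancel : ∀ j x q M → - x ≡ j + q * M → - j - x ≡ q * M
  cancel j x q M e = trans (cong (λ t → - j + t) e) (regroup j q M)
    where regroup : ∀ j q M → - j + (j + q * M) ≡ q * M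
          regroup = solve-∀

zeros : ℕ → Word
zeros n = replicate n false

value-zeros : ∀ n → value (zeros n) ≡ + 0
value-zeros zero    = refl
value-zeros (suc n) = cong (λ t → + 0 + + 2 * t) (value-zeros n)

zeros-suc : ∀ n → zeros (suc n) ≡ zeros n ∷ʳ false
zeros-suc zero    = refl
zeros-suc (suc n) = cong (false ∷_) (zeros-suc n)

length-orbit-zeros : ∀ j n → length (iter j γ (zeros n)) ≡ n
length-orbit-zeros j n = trans (length-iter length-γ j (zeros n)) (List.length-replicate n)

value-orbit-zeros : ∀ j n → value (iter j γ (zeros n)) ≡ - + j [mod 2^ n ]
value-orbit-zeros j n = begin
  value (iter j γ (zeros n))   ≈⟨ ≡mod-2^-cong (List.length-replicate n) (value-iter-γ j (zeros n)) ⟩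
  value (zeros n) - + j        ≡⟨ cong (λ t → t - + j) (value-zeros n) ⟩
  + 0 - + j                    ≡⟨ ℤ.+-identityˡ (- + j) ⟩
  - + j                        ∎
  where open ≡mod-Reasoning (2^ n)

orbit-zeros-surjective : ∀ n x → ∃ λ j → value (iter j γ (zeros n)) ≡ x [mod 2^ n ]
orbit-zeros-surjective n x =
  let j , -j≡x = residue-negated n x in j , ≡mod-trans (value-orbit-zeros j n) -j≡x

γ-level-transitive : ∀ u → ∃ λ j → iter j γ (zeros (length u)) ≡ u
γ-level-transitive u =
  let j , w≡u = orbit-zeros-surjective (length u) (value u)
      length-w = length-orbit-zeros j (length u)
  in j , value-injective length-w (≡mod-2^-cong (sym length-w) w≡u)

length-∷ʳ : ∀ (u : Word) x → length (u ∷ʳ x) ≡ suc (length u)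
length-∷ʳ u x = trans (List.length-++ u) (ℕ.+-comm (length u) 1)

last-∷ʳ : ∀ (u : Word) x → last (u ∷ʳ x) ≡ just x
last-∷ʳ []          x = refl
last-∷ʳ (y ∷ [])    x = refl
last-∷ʳ (y ∷ z ∷ u) x = last-∷ʳ (z ∷ u) x

lastLetter : Word → Bool
lastLetter w = fromMaybe false (last w)

extension-by-last : ∀ w {w′} → length w′ ≡ suc (length w) → value w′ ≡ value w [mod 2^ length w ] →
                    w′ ≡ w ∷ʳ lastLetter w′
extension-by-last w {w′} len w′≡w with initLast w′
... | u ∷ʳ′ x = cong₂ _∷ʳ_ u≡w (sym (cong (fromMaybe false) (last-∷ʳ u x)))
  where
  length-u : length u ≡ length w
  length-u = ℕ.suc-injective (trans (sym (length-∷ʳ u x)) len)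
  u≡w : u ≡ w
  u≡w = value-injective length-u (≡mod-2^-cong (sym length-u)
          (≡mod-trans (≡mod-sym (≡mod-2^-cong length-u (value-∷ʳ-mod u x))) w′≡w))

-- W n is a word of value c n; by coherence W (suc n) extends W n, so the last letters are the digits of s.
ℤ₂-limit : (c : ℕ → ℤ) → (∀ n → c (suc n) ≡ c n [mod 2^ n ]) →
           ∃ λ s → ∀ n → truncℤ s n ≡ c n [mod 2^ n ]
ℤ₂-limit c coherent = s , truncℤ-s
  where
  W : ℕ → Word
  W n = iter (proj₁ (orbit-zeros-surjective n (c n))) γ (zeros n)
  length-W : ∀ n → length (W n) ≡ n
  length-W n = length-orbit-zeros (proj₁ (orbit-zeros-surjective n (c n))) n
  value-W : ∀ n → value (W n) ≡ c n [mod 2^ n ]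
  value-W n = proj₂ (orbit-zeros-surjective n (c n))
  s : ℤ₂
  s n = lastLetter (W (suc n))
  W-suc : ∀ n → W (suc n) ≡ W n ∷ʳ s n
  W-suc n = extension-by-last (W n) (trans (length-W (suc n)) (cong suc (sym (length-W n))))
    (≡mod-2^-cong (sym (length-W n)) (begin
      value (W (suc n))   ≈⟨ ≡mod-divisor (divides (+ 2) refl) (value-W (suc n)) ⟩
      c (suc n)           ≈⟨ coherent n ⟩
      c n                 ≈⟨ value-W n ⟨
      value (W n)         ∎))
    where open ≡mod-Reasoning (2^ n)
  digits-s : ∀ n → digits s n ≡ W n
  digits-s zero    = value-injective (sym (length-W 0)) ≡mod-1
  digits-s (suc n) = trans (digits-suc s n) (trans (cong (_∷ʳ s n) (digits-s n)) (sym (W-suc n)))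
  truncℤ-s : ∀ n → truncℤ s n ≡ c n [mod 2^ n ]
  truncℤ-s n = begin
    truncℤ s n           ≡⟨ value-digits s n ⟨
    value (digits s n)   ≡⟨ cong value (digits-s n) ⟩
    value (W n)          ≈⟨ value-W n ⟩
    c n                  ∎
    where open ≡mod-Reasoning (2^ n)

unit-truncℤ : ∀ k → IsUnit k → ∀ n → truncℤ k (suc n) ≡ + 1 + + 2 * truncℤ (half-pred k) n
unit-truncℤ k k-unit n = trans (truncℤ-suc k n) (cong (λ b → digit b + + 2 * truncℤ (half-pred k) n) k-unit)

unit-if-odd : ∀ k → truncℤ k 1 ≢ + 0 → IsUnit k
unit-if-odd k odd with k 0
... | true  = refl
... | false = ⊥-elim (odd refl)

odd-invertible : ∀ c n → ∃ λ u → (+ 1 + + 2 * c) * u ≡ + 1 [mod 2^ n ]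
odd-invertible c zero    = + 0 , ≡mod-1
odd-invertible c (suc n) with u , congruent (divides q ou-1≡q2ⁿ) ← odd-invertible c n =
  u - q * 2^ n , congruent (divides (- (c * q)) (lift c u q (2^ n) ou-1≡q2ⁿ))
  where
  lift : ∀ c u q M → (+ 1 + + 2 * c) * u - + 1 ≡ q * M →
         (+ 1 + + 2 * c) * (u - q * M) - + 1 ≡ - (c * q) * (+ 2 * M)
  lift c u q M e = begin
    (+ 1 + + 2 * c) * (u - q * M) - + 1                   ≡⟨ regroup₁ c u q M ⟩
    ((+ 1 + + 2 * c) * u - + 1) - (+ 1 + + 2 * c) * q * M ≡⟨ cong (λ t → t - (+ 1 + + 2 * c) * q * M) e ⟩
    q * M - (+ 1 + + 2 * c) * q * M                       ≡⟨ regroup₂ c q M ⟩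
    - (c * q) * (+ 2 * M)                                 ∎
    where
    open ≡-Reasoning
    regroup₁ : ∀ c u q M →
               (+ 1 + + 2 * c) * (u - q * M) - + 1 ≡ ((+ 1 + + 2 * c) * u - + 1) - (+ 1 + + 2 * c) * q * M
    regroup₁ = solve-∀
    regroup₂ : ∀ c q M → q * M - (+ 1 + + 2 * c) * q * M ≡ - (c * q) * (+ 2 * M)
    regroup₂ = solve-∀

unit-invertible : ∀ k → IsUnit k → ∀ n → ∃ λ u → truncℤ k n * u ≡ + 1 [mod 2^ n ]
unit-invertible _ k-unit zero    = + 0 , ≡mod-1
unit-invertible k k-unit (suc n) =
  subst (λ t → ∃ λ u → t * u ≡ + 1 [mod 2^ suc n ]) (sym (unit-truncℤ k k-unit n))
        (odd-invertible (truncℤ (half-pred k) n) (suc n))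

unit-cancel : ∀ k → IsUnit k → ∀ n {a b} →
              truncℤ k n * a ≡ truncℤ k n * b [mod 2^ n ] → a ≡ b [mod 2^ n ]
unit-cancel k k-unit n =
  let u , ku≡1 = unit-invertible k k-unit n in invertible-cancel (truncℤ k n) u ku≡1

ℤ₂-inverse : ∀ k → IsUnit k → ∃ λ k⁻¹ → ∀ n → truncℤ k n * truncℤ k⁻¹ n ≡ + 1 [mod 2^ n ]
ℤ₂-inverse k k-unit = k⁻¹ , λ n → ≡mod-trans (*-congˡ-mod (truncℤ k n) (k⁻¹≡u n)) (ku≡1 n)
  where
  u : ℕ → ℤ
  u n = proj₁ (unit-invertible k k-unit n)
  ku≡1 : ∀ n → truncℤ k n * u n ≡ + 1 [mod 2^ n ]
  ku≡1 n = proj₂ (unit-invertible k k-unit n)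
  u-coherent : ∀ n → u (suc n) ≡ u n [mod 2^ n ]
  u-coherent n = unit-cancel k k-unit n (begin
    truncℤ k n * u (suc n)         ≈⟨ *-congʳ-mod (u (suc n)) (truncℤ-coherent k n) ⟨
    truncℤ k (suc n) * u (suc n)   ≈⟨ ≡mod-divisor (divides (+ 2) refl) (ku≡1 (suc n)) ⟩
    + 1                            ≈⟨ ku≡1 n ⟨
    truncℤ k n * u n               ∎)
    where open ≡mod-Reasoning (2^ n)
  k⁻¹ : ℤ₂
  k⁻¹ = proj₁ (ℤ₂-limit u u-coherent)
  k⁻¹≡u : ∀ n → truncℤ k⁻¹ n ≡ u n [mod 2^ n ]
  k⁻¹≡u = proj₂ (ℤ₂-limit u u-coherent)

ℤ₂-product : ∀ k m → ∃ λ s → ∀ n → truncℤ s n ≡ truncℤ k n * truncℤ m n [mod 2^ n ]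
ℤ₂-product k m = ℤ₂-limit (λ n → truncℤ k n * truncℤ m n)
                          (λ n → *-cong-mod (truncℤ-coherent k n) (truncℤ-coherent m n))

ℤ₂-divide : ∀ k → IsUnit k → ∀ r →
            ∃ λ s → ∀ n → truncℤ k n * truncℤ s n ≡ truncℤ r n [mod 2^ n ]
ℤ₂-divide k k-unit r = s , ks≡r
  where
  k⁻¹ : ℤ₂
  k⁻¹ = proj₁ (ℤ₂-inverse k k-unit)
  s : ℤ₂
  s = proj₁ (ℤ₂-product k⁻¹ r)
  ks≡r : ∀ n → truncℤ k n * truncℤ s n ≡ truncℤ r n [mod 2^ n ]
  ks≡r n = begin
    truncℤ k n * truncℤ s n                     ≈⟨ *-congˡ-mod (truncℤ k n) (proj₂ (ℤ₂-product k⁻¹ r) n) ⟩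
    truncℤ k n * (truncℤ k⁻¹ n * truncℤ r n)    ≡⟨ ℤ.*-assoc (truncℤ k n) _ _ ⟨
    truncℤ k n * truncℤ k⁻¹ n * truncℤ r n      ≈⟨ *-congʳ-mod (truncℤ r n) (proj₂ (ℤ₂-inverse k k-unit) n) ⟩
    + 1 * truncℤ r n                            ≡⟨ ℤ.*-identityˡ (truncℤ r n) ⟩
    truncℤ r n                                  ∎
    where open ≡mod-Reasoning (2^ n)

value-zAux : ∀ k → IsUnit k → ∀ n v → length v ≡ n →
             truncℤ k n * value (zAux k n v) ≡ value v [mod 2^ n ]
value-zAux k k-unit zero    v           _   = ≡mod-1
value-zAux k k-unit (suc n) (false ∷ v) len = begin
  truncℤ k (suc n) * (+ 0 + + 2 * value (zAux k n v))  ≡⟨ regroup (truncℤ k (suc n)) (value (zAux k n v)) ⟩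
  + 2 * (truncℤ k (suc n) * value (zAux k n v))        ≈⟨ *-scale-mod (+ 2) lower-level ⟩
  + 2 * value v                                        ≡⟨ ℤ.+-identityˡ (+ 2 * value v) ⟨
  + 0 + + 2 * value v                                  ∎
  where
  open ≡mod-Reasoning (2^ suc n)
  regroup : ∀ t x → t * (+ 0 + + 2 * x) ≡ + 2 * (t * x)
  regroup = solve-∀
  lower-level : truncℤ k (suc n) * value (zAux k n v) ≡ value v [mod 2^ n ]
  lower-level = ≡mod-trans (*-congʳ-mod _ (truncℤ-coherent k n)) (value-zAux k k-unit n v (ℕ.suc-injective len))
value-zAux k k-unit (suc n) (true ∷ v)  len = begin
  K * (+ 1 + + 2 * value (zAux k n w))        ≡⟨ regroup₁ K (value (zAux k n w)) ⟩
  K + + 2 * (K * value (zAux k n w))          ≈⟨ +-congˡ-mod K (*-scale-mod (+ 2) lower-level) ⟩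
  K + + 2 * value w                           ≡⟨ cong (λ t → t + + 2 * value w) (unit-truncℤ k k-unit n) ⟩
  + 1 + + 2 * ℓₙ + + 2 * value w              ≡⟨ regroup₂ ℓₙ (value w) ⟩
  + 1 + + 2 * (value w + ℓₙ)                  ≈⟨ +-congˡ-mod (+ 1) (*-scale-mod (+ 2) w+ℓ≡v) ⟩
  + 1 + + 2 * value v                         ∎
  where
  open ≡mod-Reasoning (2^ suc n)
  K ℓₙ : ℤ
  K = truncℤ k (suc n)
  ℓₙ = truncℤ (half-pred k) n
  w : Word
  w = γ^ (half-pred k) v
  regroup₁ : ∀ t x → t * (+ 1 + + 2 * x) ≡ t + + 2 * (t * x)
  regroup₁ = solve-∀
  regroup₂ : ∀ l x → + 1 + + 2 * l + + 2 * x ≡ + 1 + + 2 * (x + l)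
  regroup₂ = solve-∀
  lower-level : K * value (zAux k n w) ≡ value w [mod 2^ n ]
  lower-level = ≡mod-trans (*-congʳ-mod _ (truncℤ-coherent k n))
                  (value-zAux k k-unit n w (trans (length-γ^ (half-pred k) v) (ℕ.suc-injective len)))
  w+ℓ≡v : value w + ℓₙ ≡ value v [mod 2^ n ]
  w+ℓ≡v = ≡mod-trans (+-congʳ-mod ℓₙ (value-γ^ (half-pred k) v (ℕ.suc-injective len)))
                     (≡⇒≡mod (cancel (value v) ℓₙ))
    where cancel : ∀ a b → a - b + b ≡ a
          cancel = solve-∀

value-z : ∀ k → IsUnit k → ∀ {n} v → length v ≡ n → truncℤ k n * value (z k v) ≡ value v [mod 2^ n ]
value-z k k-unit v refl = value-zAux k k-unit (length v) v refl

length-child-preserving : ∀ (f : Word → Word) → (∀ v x → ∃ λ y → f (v ∷ʳ x) ≡ f v ∷ʳ y) →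
                          ∀ n v → length v ≡ n → length (f v) ≡ length (f []) ℕ.+ n
length-child-preserving f child zero    [] _ = sym (ℕ.+-identityʳ _)
length-child-preserving f child (suc n) v len with initLast v
... | u ∷ʳ′ x with y , f[ux]≡f[u]y ← child u x = begin
  length (f (u ∷ʳ x))       ≡⟨ cong length f[ux]≡f[u]y ⟩
  length (f u ∷ʳ y)         ≡⟨ length-∷ʳ (f u) y ⟩
  suc (length (f u))        ≡⟨ cong suc (length-child-preserving f child n u length-u) ⟩
  suc (length (f []) ℕ.+ n) ≡⟨ ℕ.+-suc (length (f [])) n ⟨
  length (f []) ℕ.+ suc n   ∎
  where
  open ≡-Reasoning
  length-u : length u ≡ n
  length-u = ℕ.suc-injective (trans (sym (length-∷ʳ u x)) len)

length-fun : ∀ α v → length (fun α v) ≡ length v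
length-fun α v = trans (length-child-preserving (fun α) (fun-child α) _ v refl) (cong (ℕ._+ length v) root)
  where
  root : length (fun α []) ≡ 0
  root = ℕ.m+n≡0⇒m≡0 (length (fun α []))
           (trans (sym (length-child-preserving (fun α) (fun-child α) _ (inv α []) refl)) (cong length (fun-inv α [])))

value-γ^z : ∀ k a → IsUnit k → ∀ {n} v → length v ≡ n →
            truncℤ k n * value (z k (γ^ a v)) ≡ value v - truncℤ a n [mod 2^ n ]
value-γ^z k a k-unit v len =
  ≡mod-trans (value-z k k-unit (γ^ a v) (trans (length-γ^ a v) len)) (value-γ^ a v len)

conj-γ^ : ∀ α k a → IsUnit k → fun α ≈ (λ v → z k (γ^ a v)) →
          ∀ m s → (∀ n → truncℤ k n * truncℤ s n ≡ truncℤ m n [mod 2^ n ]) → conj α (γ^ m) ≈ γ^ s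
conj-γ^ α k a k-unit α≈γ^z m s ks≡m v =
  value-injective (trans length-w (sym length-γ^sv)) (≡mod-2^-cong (sym length-w) (unit-cancel k k-unit n kw≡kγ^sv))
  where
  u w : Word
  u = inv α v
  w = fun α (γ^ m u)
  n : ℕ
  n = length u
  length-w : length w ≡ n
  length-w = trans (length-fun α (γ^ m u)) (length-γ^ m u)
  length-v : length v ≡ n
  length-v = trans (cong length (sym (fun-inv α v))) (length-fun α u)
  length-γ^sv : length (γ^ s v) ≡ n
  length-γ^sv = trans (length-γ^ s v) length-v
  K A M S : ℤ
  K = truncℤ k n
  A = truncℤ a n
  M = truncℤ m n
  S = truncℤ s n
  kw≡kγ^sv : K * value w ≡ K * value (γ^ s v) [mod 2^ n ]
  kw≡kγ^sv = begin
    K * value w                          ≡⟨ cong (λ t → K * value t) (α≈γ^z (γ^ m u)) ⟩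
    K * value (z k (γ^ a (γ^ m u)))      ≈⟨ value-γ^z k a k-unit (γ^ m u) (length-γ^ m u) ⟩
    value (γ^ m u) - A                   ≈⟨ +-congʳ-mod (- A) (value-γ^ m u refl) ⟩
    value u - M - A                      ≡⟨ swap (value u) M A ⟩
    value u - A - M                      ≈⟨ +-cong-mod (value-γ^z k a k-unit u refl) (-‿cong-mod (ks≡m n)) ⟨
    K * value (z k (γ^ a u)) - K * S     ≡⟨ cong (λ t → K * value t - K * S) (sym (α≈γ^z u)) ⟩
    K * value (fun α u) - K * S          ≡⟨ cong (λ t → K * value t - K * S) (fun-inv α v) ⟩
    K * value v - K * S                  ≡⟨ *-distribˡ-minus K (value v) S ⟨
    K * (value v - S)                    ≈⟨ *-congˡ-mod K (value-γ^ s v length-v) ⟨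
    K * value (γ^ s v)                   ∎
    where
    open ≡mod-Reasoning (2^ n)
    swap : ∀ x y z → x - y - z ≡ x - z - y
    swap = solve-∀

γ^z⇒normalizes : ∀ α → InGammaZ α → Normalizes α
γ^z⇒normalizes α (a , k , k-unit , α≈γ^z) = conjugates , preimages
  where
  conjugates : ∀ m → In⟨⟨γ⟩⟩ (conj α (γ^ m))
  conjugates m = let s , ks≡m = ℤ₂-divide k k-unit m in s , conj-γ^ α k a k-unit α≈γ^z m s ks≡m
  preimages : ∀ m → ∃ λ m′ → γ^ m ≈ conj α (γ^ m′)
  preimages m = let m′ , m′≡km = ℤ₂-product k m in
    m′ , λ v → sym (conj-γ^ α k a k-unit α≈γ^z m′ m (λ n → ≡mod-sym (m′≡km n)) v)

module Intertwining (β : Word → Word) (K : ℤ₂)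
                    (length-β : ∀ u → length (β u) ≡ length u)
                    (βγ≡γ^Kβ : ∀ u → β (γ u) ≡ γ^ K (β u)) where

  value-β-iter-γ : ∀ j {n} u → length u ≡ n →
                   value (β (iter j γ u)) ≡ value (β u) - + j * truncℤ K n [mod 2^ n ]
  value-β-iter-γ zero    u len = ≡⇒≡mod (sym (ℤ.+-identityʳ (value (β u))))
  value-β-iter-γ (suc j) {n} u len = begin
    value (β (iter j γ (γ u)))            ≈⟨ value-β-iter-γ j (γ u) (trans (length-γ u) len) ⟩
    value (β (γ u)) - + j * Kₙ            ≡⟨ cong (λ t → value t - + j * Kₙ) (βγ≡γ^Kβ u) ⟩
    value (γ^ K (β u)) - + j * Kₙ         ≈⟨ +-congʳ-mod (- (+ j * Kₙ)) (value-γ^ K (β u) (trans (length-β u) len)) ⟩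
    value (β u) - Kₙ - + j * Kₙ           ≡⟨ regroup (value (β u)) (+ j) Kₙ ⟩
    value (β u) - (+ 1 + + j) * Kₙ        ∎
    where
    open ≡mod-Reasoning (2^ n)
    Kₙ : ℤ
    Kₙ = truncℤ K n
    regroup : ∀ b j k → b - k - j * k ≡ b - (+ 1 + j) * k
    regroup = solve-∀

  value-β-affine : ∀ u → value (β u) ≡ value (β (zeros (length u))) + value u * truncℤ K (length u)
                                       [mod 2^ length u ]
  value-β-affine u = begin
    value (β u)                     ≡⟨ cong (λ t → value (β t)) (sym orbit) ⟩
    value (β (iter j γ (zeros n)))  ≈⟨ value-β-iter-γ j (zeros n) (List.length-replicate n) ⟩
    b - + j * Kₙ                    ≡⟨ cong (λ t → b + t) (ℤ.neg-distribˡ-* (+ j) Kₙ) ⟩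
    b + - + j * Kₙ                  ≈⟨ +-congˡ-mod b (*-congʳ-mod Kₙ -j≡u) ⟩
    b + value u * Kₙ                ∎
    where
    open ≡mod-Reasoning (2^ length u)
    n j : ℕ
    n = length u
    j = proj₁ (γ-level-transitive u)
    orbit : iter j γ (zeros n) ≡ u
    orbit = proj₂ (γ-level-transitive u)
    -j≡u : - + j ≡ value u [mod 2^ n ]
    -j≡u = ≡mod-trans (≡mod-sym (value-orbit-zeros j n)) (≡⇒≡mod (cong value orbit))
    b Kₙ : ℤ
    b = value (β (zeros n))
    Kₙ = truncℤ K n

  intertwiner-unit : (∀ u v → β u ≡ β v → u ≡ v) → IsUnit K
  intertwiner-unit β-injective =
    unit-if-odd K λ K₁≡0 → case β-injective (false ∷ []) (true ∷ []) (β0≡β1 K₁≡0) of λ ()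
    where
    β-level-one : ∀ x → truncℤ K 1 ≡ + 0 → value (β (x ∷ [])) ≡ value (β (zeros 1)) [mod 2^ 1 ]
    β-level-one x K₁≡0 = begin
      value (β (x ∷ []))                                ≈⟨ value-β-affine (x ∷ []) ⟩
      value (β (zeros 1)) + value (x ∷ []) * truncℤ K 1 ≡⟨ cong (λ t → value (β (zeros 1)) + value (x ∷ []) * t) K₁≡0 ⟩
      value (β (zeros 1)) + value (x ∷ []) * + 0        ≡⟨ annihilate (value (β (zeros 1))) (value (x ∷ [])) ⟩
      value (β (zeros 1))                               ∎
      where
      open ≡mod-Reasoning (2^ 1)
      annihilate : ∀ b x → b + x * + 0 ≡ b
      annihilate = solve-∀
    β0≡β1 : truncℤ K 1 ≡ + 0 → β (false ∷ []) ≡ β (true ∷ [])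
    β0≡β1 K₁≡0 = value-injective (trans (length-β _) (sym (length-β _))) (≡mod-2^-cong (sym (length-β _))
                   (≡mod-trans (β-level-one false K₁≡0) (≡mod-sym (β-level-one true K₁≡0))))

-- z k ∘ γ^ m acts on level n as x ↦ K (x − m) = b + K x, for m = − k b and k = K⁻¹.
affine-is-γ^z : ∀ (β : Word → Word) K → IsUnit K → (∀ u → length (β u) ≡ length u) →
                (b : ℕ → ℤ) → (∀ n → b (suc n) ≡ b n [mod 2^ n ]) →
                (∀ u → value (β u) ≡ b (length u) + value u * truncℤ K (length u) [mod 2^ length u ]) →
                ∃ λ m → ∃ λ k → IsUnit k × (β ≈ λ v → z k (γ^ m v))
affine-is-γ^z β K K-unit length-β b b-coherent β-affine = m , k , k-unit , β≈γ^z
  where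
  k : ℤ₂
  k = proj₁ (ℤ₂-inverse K K-unit)
  Kk≡1 : ∀ n → truncℤ K n * truncℤ k n ≡ + 1 [mod 2^ n ]
  Kk≡1 = proj₂ (ℤ₂-inverse K K-unit)
  k-unit : IsUnit k
  k-unit = unit-if-odd k λ k₁≡0 → 1≢0-mod-2 (begin
    + 1                          ≈⟨ Kk≡1 1 ⟨
    truncℤ K 1 * truncℤ k 1      ≡⟨ cong (λ t → truncℤ K 1 * t) k₁≡0 ⟩
    truncℤ K 1 * + 0             ≡⟨ ℤ.*-zeroʳ (truncℤ K 1) ⟩
    + 0                          ∎)
    where open ≡mod-Reasoning (2^ 1)
  mₙ : ℕ → ℤ
  mₙ n = - (truncℤ k n * b n)
  mₙ-coherent : ∀ n → mₙ (suc n) ≡ mₙ n [mod 2^ n ]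
  mₙ-coherent n = -‿cong-mod (*-cong-mod (truncℤ-coherent k n) (b-coherent n))
  m : ℤ₂
  m = proj₁ (ℤ₂-limit mₙ mₙ-coherent)
  m≡mₙ : ∀ n → truncℤ m n ≡ mₙ n [mod 2^ n ]
  m≡mₙ = proj₂ (ℤ₂-limit mₙ mₙ-coherent)
  β≈γ^z : β ≈ λ v → z k (γ^ m v)
  β≈γ^z u = value-injective (trans (length-β u) (sym length-γ^z)) (≡mod-2^-cong (sym (length-β u))
              (unit-cancel k k-unit n (≡mod-trans kβ≡u+kb (≡mod-sym kγ^z≡u+kb))))
    where
    open ≡mod-Reasoning (2^ length u)
    n : ℕ
    n = length u
    kₙ Kₙ : ℤ
    kₙ = truncℤ k n
    Kₙ = truncℤ K n
    length-γ^z : length (z k (γ^ m u)) ≡ n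
    length-γ^z = trans (length-z k (γ^ m u)) (length-γ^ m u)
    kβ≡u+kb : kₙ * value (β u) ≡ value u + kₙ * b n [mod 2^ n ]
    kβ≡u+kb = begin
      kₙ * value (β u)                     ≈⟨ *-congˡ-mod kₙ (β-affine u) ⟩
      kₙ * (b n + value u * Kₙ)            ≡⟨ regroup kₙ (b n) (value u) Kₙ ⟩
      value u * (Kₙ * kₙ) + kₙ * b n       ≈⟨ +-congʳ-mod (kₙ * b n) (*-congˡ-mod (value u) (Kk≡1 n)) ⟩
      value u * + 1 + kₙ * b n             ≡⟨ cong (λ t → t + kₙ * b n) (ℤ.*-identityʳ (value u)) ⟩
      value u + kₙ * b n                   ∎
      where
      regroup : ∀ k b x K → k * (b + x * K) ≡ x * (K * k) + k * b
      regroup = solve-∀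
    kγ^z≡u+kb : kₙ * value (z k (γ^ m u)) ≡ value u + kₙ * b n [mod 2^ n ]
    kγ^z≡u+kb = begin
      kₙ * value (z k (γ^ m u))    ≈⟨ value-γ^z k m k-unit u refl ⟩
      value u - truncℤ m n         ≈⟨ +-congˡ-mod (value u) (-‿cong-mod (m≡mₙ n)) ⟩
      value u - - (kₙ * b n)       ≡⟨ cong (λ t → value u + t) (ℤ.neg-involutive (kₙ * b n)) ⟩
      value u + kₙ * b n           ∎

one : ℤ₂
one zero    = true
one (suc _) = false

trunc-zero : ∀ n → trunc (λ _ → false) n ≡ 0
trunc-zero zero    = refl
trunc-zero (suc n) = cong (2 ℕ.*_) (trunc-zero n)

γ^-one : ∀ v → γ^ one v ≡ γ v
γ^-one []      = refl
γ^-one (x ∷ w) = cong (λ t → iter (1 ℕ.+ 2 ℕ.* t) γ (x ∷ w)) (trunc-zero (length w))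

fun-injective : ∀ α {u v} → fun α u ≡ fun α v → u ≡ v
fun-injective α {u} {v} αu≡αv = trans (sym (inv-fun α u)) (trans (cong (inv α) αu≡αv) (inv-fun α v))

value-fun-∷ʳ : ∀ α u x → value (fun α (u ∷ʳ x)) ≡ value (fun α u) [mod 2^ length u ]
value-fun-∷ʳ α u x with y , α[ux]≡α[u]y ← fun-child α u x =
  ≡mod-trans (≡⇒≡mod (cong value α[ux]≡α[u]y))
             (≡mod-2^-cong (length-fun α u) (value-∷ʳ-mod (fun α u) y))

-- Only the inclusion α⁻¹ ⟨⟨γ⟩⟩ α ⊆ ⟨⟨γ⟩⟩ is needed, and only for the conjugate of γ itself.
normalizes⇒γ^z : ∀ α → Normalizes α → InGammaZ α
normalizes⇒γ^z α (conj-γ^-in , _) =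
  affine-is-γ^z (fun α) K K-unit (length-fun α) b b-coherent value-β-affine
  where
  K : ℤ₂
  K = proj₁ (conj-γ^-in one)
  intertwines : ∀ u → fun α (γ u) ≡ γ^ K (fun α u)
  intertwines u = begin
    fun α (γ u)                          ≡⟨ cong (λ t → fun α (γ t)) (inv-fun α u) ⟨
    fun α (γ (inv α (fun α u)))          ≡⟨ cong (fun α) (γ^-one _) ⟨
    conj α (γ^ one) (fun α u)            ≡⟨ proj₂ (conj-γ^-in one) (fun α u) ⟩
    γ^ K (fun α u)                       ∎
    where open ≡-Reasoning
  open Intertwining (fun α) K (length-fun α) intertwines
  K-unit : IsUnit K
  K-unit = intertwiner-unit λ _ _ → fun-injective α
  b : ℕ → ℤ
  b n = value (fun α (zeros n))
  b-coherent : ∀ n → b (suc n) ≡ b n [mod 2^ n ]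
  b-coherent n = ≡mod-trans (≡⇒≡mod (cong (λ t → value (fun α t)) (zeros-suc n)))
                            (≡mod-2^-cong (List.length-replicate n) (value-fun-∷ʳ α (zeros n) false))

proposition4p4 : ∀ (α : Aut) → Normalizes α ⇔ InGammaZ α
proposition4p4 α = mk⇔ (normalizes⇒γ^z α) (γ^z⇒normalizes α)
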